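{- For every odd $k\geq5$ and every even $d\geq2$ there exists a bipartite Cayley digraph of order $2(k-1)\left(\frac{d}{2}\right)^{k-1}$, degree $d$ and diameter at most $k$.
   Context: A Cayley digraph $Cay(\Gamma,X)$ of a group $\Gamma$ with respect to a generating set $X$ not containing the identity has vertex set $\Gamma$ and an arc from $u$ to $v$ iff $ux=v$ for some $x\in X$; its degree is $|X|$ and its order is $|\Gamma|$. It is bipartite if its vertex set can be partitioned into two parts such that every arc joins vertices in different parts. The diameter is the maximum directed distance between vertices. -}

module Defs where

open import Data.Nat using (ℕ; zero; suc; _≤_; _*_; _^_; _∸_; _/_)
open import Data.Nat.Divisibility using (_∣_)
open import Data.Fin using (Fin)
open import Data.List using (List; []; _∷_; length)
open import Data.List.Membership.Propositional using (_∈_; _∉_)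
open import Data.List.Relation.Unary.Unique.Propositional using (Unique)
open import Data.Product using (Σ; ∃; ∃-syntax; _×_; _,_)
open import Data.Sum using (_⊎_)
open import Data.Bool using (Bool)
open import Relation.Binary.PropositionalEquality using (_≡_; _≢_)
open import Relation.Nullary using (¬_)
open import Algebra.Structures using (IsGroup)

-- A finite group whose underlying set is Fin n (so its order is n),
-- with propositional equality as the group equality.
record FinGroup (n : ℕ) : Set where
  field
    _∙_     : Fin n → Fin n → Fin n
    ε       : Fin n
    _⁻¹     : Fin n → Fin n
    isGroup : IsGroup _≡_ _∙_ ε _⁻¹
  infixl 7 _∙_

module _ {n : ℕ} (Γ : FinGroup n) where
  open FinGroup Γ

  prod : List (Fin n) → Fin n
  prod []       = ε
  prod (g ∷ gs) = g ∙ prod gs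

  Generates : List (Fin n) → Set
  Generates X = ∀ (g : Fin n) → ∃[ w ] (prod w ≡ g × (∀ {y} → y ∈ w → y ∈ X ⊎ ∃[ x ] (x ∈ X × y ≡ x ⁻¹)))

  -- X is a generating set of size d not containing the identity
  -- (as a list without repetitions, so |X| = length X)
  GeneratingSetOfSize : List (Fin n) → ℕ → Set
  GeneratingSetOfSize X d = Unique X × ε ∉ X × length X ≡ d × Generates X

  Arc : List (Fin n) → Fin n → Fin n → Set
  Arc X u v = ∃[ x ] (x ∈ X × u ∙ x ≡ v)

  data Walk (X : List (Fin n)) : Fin n → Fin n → ℕ → Set where
    here : ∀ {u} → Walk X u u zero
    step : ∀ {u v w l} → Arc X u v → Walk X v w l → Walk X u w (suc l)

  DiameterAtMost : List (Fin n) → ℕ → Set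
  DiameterAtMost X k = ∀ (u v : Fin n) → ∃[ l ] (l ≤ k × Walk X u v l)

  Bipartite : List (Fin n) → Set
  Bipartite X = Σ (Fin n → Bool) λ c → (∀ (u v : Fin n) → Arc X u v → c u ≢ c v)

-- Put K = k − 1, which is even, and M = d / 2. The group is ℤ/2 × (ℤ/M ≀ ℤ/K): a parity,
-- a position on a K-cycle and a lamp in ℤ/M at every position, so it has order 2K·M^K.
-- Its d generators flip the parity, multiply the lamp at the current position by any
-- element of ℤ/M, and then move by 1 or 2. Since every generator flips the parity, the
-- Cayley digraph is bipartite. An element is reached from the identity by any walk with
-- steps 1 and 2 that visits every position, ends at the right position and has length
-- of the right parity, fixing each lamp on the way. The walk 2^a 1^b 2^a s 1^ρ with
-- 2a + b = K − 1 and s ∈ {1, 2} visits every position, has length K + ρ ≤ k, and a and s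
-- can be chosen to end anywhere.

module Submission where

open import Defs
open import Level using (0ℓ)
open import Algebra.Bundles using (Group)
open import Algebra.Structures using (IsGroup)
import Algebra.Properties.Group as GroupProperties
open import Data.Bool using (Bool; true; false)
open import Data.Nat using (ℕ; zero; suc; _+_; _*_; _^_; _∸_; _/_; _%_; _≤_; _<_; z≤n; s≤s; s≤s⁻¹; _<?_)
open import Data.Nat.Properties
  using (+-identityʳ; +-assoc; +-comm; *-comm; *-identityʳ; +-cancelˡ-<; *-cancelʳ-<; +-monoʳ-≤;
         ≤-refl; ≤-reflexive; ≤-trans; ≤-antisym; <-trans; <⇒≤; ≮⇒≥; n<1+n; n≤1+n;
         m≤n⇒m<n∨m≡n; m+[n∸m]≡n)
open import Data.Nat.DivMod using (_mod_; m%n<n; m<n⇒m%n≡m; %-distribˡ-+; n%n≡0; [m+n]%n≡m%n; %-remove-+ˡ; m*n/n≡m)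
open import Data.Nat.Divisibility using (_∣_; divides)
open import Data.Nat.ListAction using (sum)
open import Data.Nat.ListAction.Properties using (sum-++)
open import Data.Nat.Tactic.RingSolver using (solve-∀)
open import Data.Fin using (Fin; zero; suc; toℕ; combine; finToFun; funToFin)
open import Data.Fin.Properties using (toℕ-injective; toℕ-fromℕ<; toℕ<n; *↔×; finToFun-funToFin; funToFin-finToFin; _≟_)
open import Data.Vec using (Vec; lookup; tabulate; zipWith; _[_]≔_)
import Data.Vec as Vec
open import Data.Vec.Properties
  using (lookup∘tabulate; tabulate∘lookup; tabulate-cong; lookup-zipWith; lookup∘update; lookup∘update′;
         lookup-replicate; zipWith-assoc; zipWith-identityˡ; zipWith-identityʳ; zipWith-inverseˡ; zipWith-inverseʳ)
open import Data.List using (List; []; _∷_; _++_; foldl; map; replicate; length; allFin; cartesianProductWith)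
open import Data.List.Properties using (length-++; length-map; length-replicate; length-tabulate)
open import Data.List.Membership.Propositional using (_∈_; _∉_)
open import Data.List.Membership.Propositional.Properties
  using (∈-map⁺; ∈-allFin; ∈-cartesianProductWith⁺; ∈-cartesianProductWith⁻)
open import Data.List.Relation.Unary.Any using (here; there)
open import Data.List.Relation.Unary.All using (All; []; _∷_)
import Data.List.Relation.Unary.All as All
import Data.List.Relation.Unary.All.Properties as All
open import Data.List.Relation.Unary.AllPairs using ([]; _∷_)
open import Data.List.Relation.Unary.Unique.Propositional using (Unique)
open import Data.List.Relation.Unary.Unique.Propositional.Properties using (cartesianProductWith⁺; allFin⁺)
open import Data.Product using (_×_; _,_; proj₁; proj₂; ∃-syntax)
open import Data.Product.Function.NonDependent.Propositional using (_×-↔_)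
open import Data.Sum using (_⊎_; inj₁; inj₂)
open import Function using (_∘_; const; Inverse; _↔_; mk↔ₛ′)
open import Function.Properties.Inverse using (↔-sym; ↔-trans)
open import Relation.Nullary using (¬_; yes; no; contradiction)
open import Relation.Binary.PropositionalEquality

-- Groups with propositional equality

record ≡-Group : Set₁ where
  infixl 7 _∙_
  field
    Carrier : Set
    _∙_     : Carrier → Carrier → Carrier
    ε       : Carrier
    _⁻¹     : Carrier → Carrier
    isGroup : IsGroup _≡_ _∙_ ε _⁻¹

  open IsGroup isGroup public
    using (assoc; identityˡ; identityʳ; inverseˡ; inverseʳ)

  group : Group 0ℓ 0ℓ
  group = record { isGroup = isGroup }

  open GroupProperties group public
    using (ε⁻¹≈ε; ⁻¹-anti-homo-∙; ⁻¹-injective; inverseˡ-unique; identityʳ-unique)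

fromFinGroup : ∀ {n} → FinGroup n → ≡-Group
fromFinGroup G = record { FinGroup G }

mkIsGroup : ∀ {A : Set} {_∙_ : A → A → A} {ε : A} {_⁻¹ : A → A} →
  (∀ x y z → (x ∙ y) ∙ z ≡ x ∙ (y ∙ z)) →
  (∀ x → ε ∙ x ≡ x) → (∀ x → x ∙ ε ≡ x) →
  (∀ x → (x ⁻¹) ∙ x ≡ ε) → (∀ x → x ∙ (x ⁻¹) ≡ ε) →
  IsGroup _≡_ _∙_ ε _⁻¹
mkIsGroup {_∙_ = _∙_} {_⁻¹ = _⁻¹} assoc idˡ idʳ invˡ invʳ = record
  { isMonoid = record
    { isSemigroup = record
      { isMagma = record { isEquivalence = isEquivalence ; ∙-cong = cong₂ _∙_ }
      ; assoc = assoc }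
    ; identity = idˡ , idʳ }
  ; inverse = invˡ , invʳ
  ; ⁻¹-cong = cong _⁻¹ }

record Action (H N : ≡-Group) : Set where
  private
    module H = ≡-Group H
    module N = ≡-Group N
  field
    act    : H.Carrier → N.Carrier → N.Carrier
    act-∙ˡ : ∀ h x y → act h (x N.∙ y) ≡ act h x N.∙ act h y
    act-ε  : ∀ x → act H.ε x ≡ x
    act-∙  : ∀ h h′ x → act (h H.∙ h′) x ≡ act h (act h′ x)

  act-εʳ : ∀ h → act h N.ε ≡ N.ε
  act-εʳ h = N.identityʳ-unique (act h N.ε) (act h N.ε)
    (trans (sym (act-∙ˡ h N.ε N.ε)) (cong (act h) (N.identityˡ N.ε)))

module _ (H N : ≡-Group) (α : Action H N) where
  private
    module H = ≡-Group H
    module N = ≡-Group N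
  open Action α

  private
    infixl 7 _·_
    _·_ : H.Carrier × N.Carrier → H.Carrier × N.Carrier → H.Carrier × N.Carrier
    (h , x) · (h′ , y) = h H.∙ h′ , x N.∙ act h y

  -- N ⋊ H, with the acting factor H written first.
  semidirect : ≡-Group
  semidirect = record
    { Carrier = H.Carrier × N.Carrier
    ; _∙_ = _·_
    ; ε = H.ε , N.ε
    ; _⁻¹ = λ (h , x) → h H.⁻¹ , act (h H.⁻¹) (x N.⁻¹)
    ; isGroup = mkIsGroup assoc′ idˡ idʳ invˡ invʳ
    }
    where
    assoc′ : ∀ g g′ g″ → (g · g′) · g″ ≡ g · (g′ · g″)
    assoc′ (h , x) (h′ , y) (h″ , z) = cong₂ _,_ (H.assoc h h′ h″) (begin
      x N.∙ act h y N.∙ act (h H.∙ h′) z     ≡⟨ N.assoc x (act h y) _ ⟩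
      x N.∙ (act h y N.∙ act (h H.∙ h′) z)   ≡⟨ cong (λ u → x N.∙ (act h y N.∙ u)) (act-∙ h h′ z) ⟩
      x N.∙ (act h y N.∙ act h (act h′ z))   ≡⟨ cong (x N.∙_) (sym (act-∙ˡ h y (act h′ z))) ⟩
      x N.∙ act h (y N.∙ act h′ z)           ∎)
      where open ≡-Reasoning
    idˡ : ∀ g → (H.ε , N.ε) · g ≡ g
    idˡ (h , x) = cong₂ _,_ (H.identityˡ h) (trans (N.identityˡ _) (act-ε x))
    idʳ : ∀ g → g · (H.ε , N.ε) ≡ g
    idʳ (h , x) = cong₂ _,_ (H.identityʳ h) (trans (cong (x N.∙_) (act-εʳ h)) (N.identityʳ x))
    invˡ : ∀ g → (proj₁ g H.⁻¹ , act (proj₁ g H.⁻¹) (proj₂ g N.⁻¹)) · g ≡ (H.ε , N.ε)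
    invˡ (h , x) = cong₂ _,_ (H.inverseˡ h) (begin
      act (h H.⁻¹) (x N.⁻¹) N.∙ act (h H.⁻¹) x  ≡⟨ sym (act-∙ˡ (h H.⁻¹) (x N.⁻¹) x) ⟩
      act (h H.⁻¹) (x N.⁻¹ N.∙ x)               ≡⟨ cong (act (h H.⁻¹)) (N.inverseˡ x) ⟩
      act (h H.⁻¹) N.ε                          ≡⟨ act-εʳ (h H.⁻¹) ⟩
      N.ε                                       ∎)
      where open ≡-Reasoning
    invʳ : ∀ g → g · (proj₁ g H.⁻¹ , act (proj₁ g H.⁻¹) (proj₂ g N.⁻¹)) ≡ (H.ε , N.ε)
    invʳ (h , x) = cong₂ _,_ (H.inverseʳ h) (begin
      x N.∙ act h (act (h H.⁻¹) (x N.⁻¹))  ≡⟨ cong (x N.∙_) (sym (act-∙ h (h H.⁻¹) (x N.⁻¹))) ⟩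
      x N.∙ act (h H.∙ h H.⁻¹) (x N.⁻¹)    ≡⟨ cong (λ u → x N.∙ act u (x N.⁻¹)) (H.inverseʳ h) ⟩
      x N.∙ act H.ε (x N.⁻¹)               ≡⟨ cong (x N.∙_) (act-ε (x N.⁻¹)) ⟩
      x N.∙ x N.⁻¹                         ≡⟨ N.inverseʳ x ⟩
      N.ε                                  ∎)
      where open ≡-Reasoning

trivialAction : (H N : ≡-Group) → Action H N
trivialAction H N = record
  { act = λ _ x → x ; act-∙ˡ = λ _ _ _ → refl ; act-ε = λ _ → refl ; act-∙ = λ _ _ _ → refl }

directProduct : ≡-Group → ≡-Group → ≡-Group
directProduct H N = semidirect H N (trivialAction H N)

vecGroup : ≡-Group → ℕ → ≡-Group
vecGroup C k = record
  { Carrier = Vec Carrier k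
  ; _∙_ = zipWith _∙_
  ; ε = Vec.replicate k ε
  ; _⁻¹ = Vec.map _⁻¹
  ; isGroup = mkIsGroup (zipWith-assoc assoc) (zipWith-identityˡ identityˡ) (zipWith-identityʳ identityʳ)
                        (zipWith-inverseˡ inverseˡ) (zipWith-inverseʳ inverseʳ)
  }
  where open ≡-Group C

lookup-extensionality : ∀ {A : Set} {k} {v w : Vec A k} → (∀ i → lookup v i ≡ lookup w i) → v ≡ w
lookup-extensionality {v = v} {w} eq = trans (sym (tabulate∘lookup v)) (trans (tabulate-cong eq) (tabulate∘lookup w))

module _ {n : ℕ} (G : ≡-Group) (iso : ≡-Group.Carrier G ↔ Fin n) where
  open ≡-Group G
  open Inverse iso using (to; from; strictlyInverseˡ; strictlyInverseʳ)

  transport : FinGroup n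
  transport = record
    { _∙_ = λ a b → to (from a ∙ from b)
    ; ε = to ε
    ; _⁻¹ = λ a → to (from a ⁻¹)
    ; isGroup = mkIsGroup
        (λ a b c → cong to (begin
           from (to (from a ∙ from b)) ∙ from c  ≡⟨ cong (_∙ from c) (strictlyInverseʳ _) ⟩
           from a ∙ from b ∙ from c              ≡⟨ assoc (from a) (from b) (from c) ⟩
           from a ∙ (from b ∙ from c)            ≡⟨ cong (from a ∙_) (sym (strictlyInverseʳ _)) ⟩
           from a ∙ from (to (from b ∙ from c))  ∎))
        (λ a → trans (cong (λ x → to (x ∙ from a)) (strictlyInverseʳ ε))
                     (trans (cong to (identityˡ (from a))) (strictlyInverseˡ a)))
        (λ a → trans (cong (λ x → to (from a ∙ x)) (strictlyInverseʳ ε))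
                     (trans (cong to (identityʳ (from a))) (strictlyInverseˡ a)))
        (λ a → trans (cong (λ x → to (x ∙ from a)) (strictlyInverseʳ _)) (cong to (inverseˡ (from a))))
        (λ a → trans (cong (λ x → to (from a ∙ x)) (strictlyInverseʳ _)) (cong to (inverseʳ (from a))))
    }
    where open ≡-Reasoning

  transport-to-∙ : ∀ x y → FinGroup._∙_ transport (to x) (to y) ≡ to (x ∙ y)
  transport-to-∙ x y = cong to (cong₂ _∙_ (strictlyInverseʳ x) (strictlyInverseʳ y))

-- Walks on a cycle with steps 1 and 2

-- The values foldl f x passes through before each element of the list (the final
-- value is not included).
partials : ∀ {A B : Set} → (A → B → A) → A → List B → List A
partials f x []       = []
partials f x (y ∷ ys) = x ∷ partials f (f x y) ys

module _ {A B : Set} {f : A → B → A} where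

  ∈-partials-++ˡ : ∀ {x y} ys {zs} → y ∈ partials f x ys → y ∈ partials f x (ys ++ zs)
  ∈-partials-++ˡ (_ ∷ _)  (here eq) = here eq
  ∈-partials-++ˡ (_ ∷ ys) (there y∈) = there (∈-partials-++ˡ ys y∈)

  ∈-partials-++ʳ : ∀ {x y z} ys {zs} → foldl f x ys ≡ z → y ∈ partials f z zs → y ∈ partials f x (ys ++ zs)
  ∈-partials-++ʳ []       refl y∈ = y∈
  ∈-partials-++ʳ (_ ∷ ys) eq   y∈ = there (∈-partials-++ʳ ys eq y∈)

foldl-+-replicate : ∀ x c s → foldl _+_ x (replicate c s) ≡ x + c * s
foldl-+-replicate x zero    s = sym (+-identityʳ x)
foldl-+-replicate x (suc c) s = trans (foldl-+-replicate (x + s) c s) (+-assoc x s (c * s))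

∈-partials-replicate : ∀ x {c} s {j} → j < c → x + j * s ∈ partials _+_ x (replicate c s)
∈-partials-replicate x {suc c} s {zero}  _         = here (+-identityʳ x)
∈-partials-replicate x {suc c} s {suc j} (s≤s j<c) =
  there (subst (_∈ partials _+_ (x + s) (replicate c s)) (+-assoc x s (j * s)) (∈-partials-replicate (x + s) s j<c))

∈-partials-replicate-∷ : ∀ x {c} s {j t ts} → j ≤ c → x + j * s ∈ partials _+_ x (replicate c s ++ t ∷ ts)
∈-partials-replicate-∷ x {c} s j≤c with m≤n⇒m<n∨m≡n j≤c
... | inj₁ j<c  = ∈-partials-++ˡ (replicate c s) (∈-partials-replicate x s j<c)
... | inj₂ refl = ∈-partials-++ʳ (replicate c s) (foldl-+-replicate x c s) (here refl)

sum-replicate : ∀ c s → sum (replicate c s) ≡ c * s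
sum-replicate zero    s = refl
sum-replicate (suc c) s = cong (s +_) (sum-replicate c s)

even-or-odd : ∀ n → ∃[ q ] (n ≡ q * 2 ⊎ n ≡ 1 + q * 2)
even-or-odd zero    = 0 , inj₁ refl
even-or-odd (suc n) with even-or-odd n
... | q , inj₁ eq = q , inj₂ (cong suc eq)
... | q , inj₂ eq = suc q , inj₁ (cong suc eq)

sweep : ℕ → ℕ → List ℕ → List ℕ
sweep a b tail = replicate a 2 ++ replicate b 1 ++ replicate a 2 ++ tail

module _ (a b t : ℕ) (ts : List ℕ) where
  private
    P : List ℕ
    P = partials _+_ 0 (sweep a b (t ∷ ts))

    K : ℕ
    K = suc (a * 2 + b)

    first : ∀ {j} → j < a → j * 2 ∈ P
    first j<a = ∈-partials-++ˡ (replicate a 2) (∈-partials-replicate 0 2 j<a)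

    middle : ∀ {j} → j < b → a * 2 + j * 1 ∈ P
    middle j<b = ∈-partials-++ʳ (replicate a 2) (foldl-+-replicate 0 a 2)
      (∈-partials-++ˡ (replicate b 1) (∈-partials-replicate (a * 2) 1 j<b))

    last : ∀ {j} → j ≤ a → a * 2 + b * 1 + j * 2 ∈ P
    last j≤a = ∈-partials-++ʳ (replicate a 2) (foldl-+-replicate 0 a 2)
      (∈-partials-++ʳ (replicate b 1) (foldl-+-replicate (a * 2) b 1)
        (∈-partials-replicate-∷ (a * 2 + b * 1) 2 j≤a))

    small : ∀ {j} → j ≤ a * 2 + b → j % K ≡ j
    small j≤ = m<n⇒m%n≡m (s≤s j≤)

    wrap : ∀ a b q → a * 2 + b * 1 + suc q * 2 ≡ 1 + q * 2 + suc (a * 2 + b)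
    wrap = solve-∀

    start : ∀ a b → a * 2 + b * 1 + 0 * 2 ≡ a * 2 + b
    start = solve-∀

  -- Evens below 2a are visited by the first block, [2a, 2a + b) by the ones, and the odd
  -- residues below 2a by the last block, which starts at 2a + b ≡ −1.
  sweep-covers : ∀ i → i ≤ a * 2 + b → ∃[ y ] (y ∈ P × y % K ≡ i)
  sweep-covers i i≤K′ with i <? a * 2
  ... | yes i<2a with even-or-odd i
  ...   | q , inj₁ refl = q * 2 , first (*-cancelʳ-< _ q a i<2a) , small i≤K′
  ...   | q , inj₂ refl = a * 2 + b * 1 + suc q * 2 , last (*-cancelʳ-< _ q a (<-trans (n<1+n (q * 2)) i<2a)) ,
          trans (cong (_% K) (wrap a b q)) (trans ([m+n]%n≡m%n i K) (small i≤K′))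
  sweep-covers i i≤K′ | no i≮2a with i <? a * 2 + b
  ... | yes i<K′ = a * 2 + (i ∸ a * 2) * 1 , middle j<b ,
          trans (cong (λ j → (a * 2 + j) % K) (*-identityʳ (i ∸ a * 2))) (trans (cong (_% K) 2a+j≡i) (small i≤K′))
    where
    2a+j≡i : a * 2 + (i ∸ a * 2) ≡ i
    2a+j≡i = m+[n∸m]≡n (≮⇒≥ i≮2a)
    j<b : i ∸ a * 2 < b
    j<b = +-cancelˡ-< (a * 2) (i ∸ a * 2) b (subst (_< a * 2 + b) (sym 2a+j≡i) i<K′)
  ... | no i≮K′ = a * 2 + b * 1 + 0 * 2 , last z≤n ,
          trans (cong (_% K) (trans (start a b) (≤-antisym (≮⇒≥ i≮K′) i≤K′))) (small i≤K′)

record Tour (K′ ρ R : ℕ) : Set where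
  field
    steps   : List ℕ
    steps⊆  : All (_∈ 1 ∷ 2 ∷ []) steps
    length≡ : length steps ≡ suc K′ + ρ
    sum≡    : sum steps ≡ K′ + ρ + R
    covers  : ∀ i → i < suc K′ → ∃[ y ] (y ∈ partials _+_ 0 steps × y % suc K′ ≡ i)

sweepTour : ∀ a b ρ s → s ∈ 1 ∷ 2 ∷ [] → Tour (a * 2 + b) ρ (s + a * 2)
sweepTour a b ρ s s∈ = record
  { steps   = sweep a b (s ∷ replicate ρ 1)
  ; steps⊆  = All.++⁺ (All.replicate⁺ a two) (All.++⁺ (All.replicate⁺ b one)
                (All.++⁺ (All.replicate⁺ a two) (s∈ ∷ All.replicate⁺ ρ one)))
  ; length≡ = length≡
  ; sum≡    = sum≡
  ; covers  = λ i i<K → sweep-covers a b s (replicate ρ 1) i (s≤s⁻¹ i<K)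
  }
  where
  one : 1 ∈ 1 ∷ 2 ∷ []
  one = here refl
  two : 2 ∈ 1 ∷ 2 ∷ []
  two = there (here refl)
  length≡ : length (sweep a b (s ∷ replicate ρ 1)) ≡ suc (a * 2 + b) + ρ
  length≡ rewrite length-++ (replicate a 2) {replicate b 1 ++ replicate a 2 ++ s ∷ replicate ρ 1}
                | length-++ (replicate b 1) {replicate a 2 ++ s ∷ replicate ρ 1}
                | length-++ (replicate a 2) {s ∷ replicate ρ 1}
                | length-replicate a {2} | length-replicate b {1} | length-replicate ρ {1}
                = count a b ρ
    where
    count : ∀ a b ρ → a + (b + (a + suc ρ)) ≡ suc (a * 2 + b) + ρ
    count = solve-∀
  sum≡ : sum (sweep a b (s ∷ replicate ρ 1)) ≡ a * 2 + b + ρ + (s + a * 2)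
  sum≡ rewrite sum-++ (replicate a 2) (replicate b 1 ++ replicate a 2 ++ s ∷ replicate ρ 1)
             | sum-++ (replicate b 1) (replicate a 2 ++ s ∷ replicate ρ 1)
             | sum-++ (replicate a 2) (s ∷ replicate ρ 1)
             | sum-replicate a 2 | sum-replicate b 1 | sum-replicate ρ 1
             = total a b ρ s
    where
    total : ∀ a b ρ s → a * 2 + (b * 1 + (a * 2 + (s + ρ * 1))) ≡ a * 2 + b + ρ + (s + a * 2)
    total = solve-∀

tour : ∀ K′ ρ R → 0 < R → R ≤ suc K′ → Tour K′ ρ R
tour K′ ρ (suc R′) _ (s≤s R′≤K′) with even-or-odd R′
... | a , inj₁ refl = subst (λ K → Tour K ρ (suc (a * 2))) (m+[n∸m]≡n R′≤K′)
                        (sweepTour a (K′ ∸ a * 2) ρ 1 (here refl))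
... | a , inj₂ refl = subst (λ K → Tour K ρ (suc (suc (a * 2)))) (m+[n∸m]≡n (<⇒≤ R′≤K′))
                        (sweepTour a (K′ ∸ a * 2) ρ 2 (there (here refl)))

-- A tour ends at K′ + ρ + R ≡ R + ρ − 1 with R ∈ [1, K′ + 1], which hits every residue.
tour-endpoint : ∀ K′ ρ r → ρ ≤ 1 → r < suc K′ →
  ∃[ R ] (0 < R × R ≤ suc K′ × (K′ + ρ + R) % suc K′ ≡ r)
tour-endpoint K′ zero r _ r<K = suc r , s≤s z≤n , r<K ,
  trans (cong (_% suc K′) (shift K′ r)) (trans ([m+n]%n≡m%n r (suc K′)) (m<n⇒m%n≡m r<K))
  where
  shift : ∀ K′ r → K′ + 0 + suc r ≡ r + suc K′
  shift = solve-∀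
tour-endpoint K′ (suc zero) zero _ _ = suc K′ , s≤s z≤n , ≤-refl ,
  trans ([m+n]%n≡m%n (K′ + 1) (suc K′)) (trans (cong (_% suc K′) (+-comm K′ 1)) (n%n≡0 (suc K′)))
tour-endpoint K′ (suc zero) (suc r) _ r<K = suc r , s≤s z≤n , <⇒≤ r<K ,
  trans (cong (_% suc K′) (shift K′ r)) (trans ([m+n]%n≡m%n (suc r) (suc K′)) (m<n⇒m%n≡m r<K))
  where
  shift : ∀ K′ r → K′ + 1 + suc r ≡ suc r + suc K′
  shift = solve-∀
tour-endpoint K′ (suc (suc _)) _ (s≤s ()) _

-- Cyclic groups

module Cyclic (n : ℕ) where
  private
    N : ℕ
    N = suc n

  ⟦_⟧ : ℕ → Fin N
  ⟦ x ⟧ = x mod N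

  toℕ-⟦⟧ : ∀ x → toℕ ⟦ x ⟧ ≡ x % N
  toℕ-⟦⟧ x = toℕ-fromℕ< (m%n<n x N)

  toℕ-⟦⟧-< : ∀ {x} → x < N → toℕ ⟦ x ⟧ ≡ x
  toℕ-⟦⟧-< {x} x<N = trans (toℕ-⟦⟧ x) (m<n⇒m%n≡m x<N)

  ⟦⟧-≡ : ∀ x {i : Fin N} → x % N ≡ toℕ i → ⟦ x ⟧ ≡ i
  ⟦⟧-≡ x eq = toℕ-injective (trans (toℕ-⟦⟧ x) eq)

  ⟦toℕ⟧ : ∀ i → ⟦ toℕ i ⟧ ≡ i
  ⟦toℕ⟧ i = ⟦⟧-≡ (toℕ i) (m<n⇒m%n≡m (toℕ<n i))

  infixl 6 _⊕_
  _⊕_ : Fin N → Fin N → Fin N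
  i ⊕ j = ⟦ toℕ i + toℕ j ⟧

  ⊖_ : Fin N → Fin N
  ⊖ i = ⟦ N ∸ toℕ i ⟧

  ⟦+⟧ : ∀ x y → ⟦ x ⟧ ⊕ ⟦ y ⟧ ≡ ⟦ x + y ⟧
  ⟦+⟧ x y = ⟦⟧-≡ (toℕ ⟦ x ⟧ + toℕ ⟦ y ⟧) (begin
    (toℕ ⟦ x ⟧ + toℕ ⟦ y ⟧) % N  ≡⟨ cong₂ (λ a b → (a + b) % N) (toℕ-⟦⟧ x) (toℕ-⟦⟧ y) ⟩
    (x % N + y % N) % N          ≡⟨ sym (%-distribˡ-+ x y N) ⟩
    (x + y) % N                  ≡⟨ sym (toℕ-⟦⟧ (x + y)) ⟩
    toℕ ⟦ x + y ⟧                ∎)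
    where open ≡-Reasoning

  ⊕-assoc : ∀ i j l → (i ⊕ j) ⊕ l ≡ i ⊕ (j ⊕ l)
  ⊕-assoc i j l = begin
    ⟦ toℕ i + toℕ j ⟧ ⊕ l                ≡⟨ cong (⟦ toℕ i + toℕ j ⟧ ⊕_) (sym (⟦toℕ⟧ l)) ⟩
    ⟦ toℕ i + toℕ j ⟧ ⊕ ⟦ toℕ l ⟧         ≡⟨ ⟦+⟧ (toℕ i + toℕ j) (toℕ l) ⟩
    ⟦ toℕ i + toℕ j + toℕ l ⟧             ≡⟨ cong ⟦_⟧ (+-assoc (toℕ i) (toℕ j) (toℕ l)) ⟩
    ⟦ toℕ i + (toℕ j + toℕ l) ⟧           ≡⟨ sym (⟦+⟧ (toℕ i) (toℕ j + toℕ l)) ⟩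
    ⟦ toℕ i ⟧ ⊕ ⟦ toℕ j + toℕ l ⟧         ≡⟨ cong (_⊕ (j ⊕ l)) (⟦toℕ⟧ i) ⟩
    i ⊕ (j ⊕ l)                          ∎
    where open ≡-Reasoning

  ⊕-comm : ∀ i j → i ⊕ j ≡ j ⊕ i
  ⊕-comm i j = cong ⟦_⟧ (+-comm (toℕ i) (toℕ j))

  ⊕-identityˡ : ∀ i → ⟦ 0 ⟧ ⊕ i ≡ i
  ⊕-identityˡ = ⟦toℕ⟧

  ⊕-inverseʳ : ∀ i → i ⊕ ⊖ i ≡ ⟦ 0 ⟧
  ⊕-inverseʳ i = begin
    i ⊕ ⊖ i                        ≡⟨ cong (_⊕ ⊖ i) (sym (⟦toℕ⟧ i)) ⟩
    ⟦ toℕ i ⟧ ⊕ ⟦ N ∸ toℕ i ⟧       ≡⟨ ⟦+⟧ (toℕ i) (N ∸ toℕ i) ⟩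
    ⟦ toℕ i + (N ∸ toℕ i) ⟧         ≡⟨ cong ⟦_⟧ (m+[n∸m]≡n (<⇒≤ (toℕ<n i))) ⟩
    ⟦ N ⟧                          ≡⟨ ⟦⟧-≡ N (n%n≡0 N) ⟩
    ⟦ 0 ⟧                          ∎
    where open ≡-Reasoning

  ℤ/ : FinGroup N
  ℤ/ = record
    { _∙_ = _⊕_
    ; ε = ⟦ 0 ⟧
    ; _⁻¹ = ⊖_
    ; isGroup = mkIsGroup ⊕-assoc ⊕-identityˡ
        (λ i → trans (⊕-comm i ⟦ 0 ⟧) (⊕-identityˡ i))
        (λ i → trans (⊕-comm (⊖ i) i) (⊕-inverseʳ i))
        ⊕-inverseʳ
    }

  foldl-⊕-⟦⟧ : ∀ x ns → foldl _⊕_ ⟦ x ⟧ (map ⟦_⟧ ns) ≡ ⟦ x + sum ns ⟧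
  foldl-⊕-⟦⟧ x []       = cong ⟦_⟧ (sym (+-comm x 0))
  foldl-⊕-⟦⟧ x (n ∷ ns) = trans (cong (λ i → foldl _⊕_ i (map ⟦_⟧ ns)) (⟦+⟧ x n))
                                (trans (foldl-⊕-⟦⟧ (x + n) ns) (cong ⟦_⟧ (+-assoc x n (sum ns))))

  partials-⟦⟧ : ∀ x ns → map ⟦_⟧ (partials _+_ x ns) ≡ partials _⊕_ ⟦ x ⟧ (map ⟦_⟧ ns)
  partials-⟦⟧ x []       = refl
  partials-⟦⟧ x (n ∷ ns) = cong (⟦ x ⟧ ∷_) (trans (partials-⟦⟧ (x + n) ns)
    (cong (λ i → partials _⊕_ i (map ⟦_⟧ ns)) (sym (⟦+⟧ x n))))

  foldl-⊕-⟦1⟧ : ∀ {A : Set} x (ys : List A) →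
    foldl _⊕_ ⟦ x ⟧ (map (const ⟦ 1 ⟧) ys) ≡ ⟦ x + length ys ⟧
  foldl-⊕-⟦1⟧ x []       = cong ⟦_⟧ (sym (+-comm x 0))
  foldl-⊕-⟦1⟧ x (_ ∷ ys) = trans (cong (λ i → foldl _⊕_ i (map (const ⟦ 1 ⟧) ys)) (⟦+⟧ x 1))
                                (trans (foldl-⊕-⟦1⟧ (x + 1) ys) (cong ⟦_⟧ (+-assoc x 1 (length ys))))

-- Cayley digraphs

module Cayley {n : ℕ} (Γ : FinGroup n) (X : List (Fin n)) where
  open FinGroup Γ
  open IsGroup isGroup using (assoc; identityˡ; identityʳ; inverseʳ)

  translate : ∀ g {u v l} → Walk Γ X u v l → Walk Γ X (g ∙ u) (g ∙ v) l
  translate g here = here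
  translate g {u} (step (x , x∈X , ux≡v) w) =
    step (x , x∈X , trans (assoc g u x) (cong (g ∙_) ux≡v)) (translate g w)

  diameter-from-ε : ∀ {k} → (∀ g → ∃[ l ] (l ≤ k × Walk Γ X ε g l)) → DiameterAtMost Γ X k
  diameter-from-ε reach u v with reach (u ⁻¹ ∙ v)
  ... | l , l≤k , w = l , l≤k , subst₂ (λ x y → Walk Γ X x y l) (identityʳ u) u[u⁻¹v]≡v (translate u w)
    where
    u[u⁻¹v]≡v : u ∙ (u ⁻¹ ∙ v) ≡ v
    u[u⁻¹v]≡v = trans (sym (assoc u (u ⁻¹) v)) (trans (cong (_∙ v) (inverseʳ u)) (identityˡ v))

  walk-word : ∀ {u v l} → Walk Γ X u v l → ∃[ w ] (u ∙ prod Γ w ≡ v × (∀ {y} → y ∈ w → y ∈ X))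
  walk-word {u} here = [] , identityʳ u , λ ()
  walk-word {u} (step (x , x∈X , ux≡v) w) with walk-word w
  ... | xs , eq , xs⊆X = x ∷ xs , trans (sym (assoc u x (prod Γ xs))) (trans (cong (_∙ prod Γ xs) ux≡v) eq) ,
                         λ { (here refl) → x∈X ; (there y∈xs) → xs⊆X y∈xs }

  generates-from-ε : ∀ {k} → (∀ g → ∃[ l ] (l ≤ k × Walk Γ X ε g l)) → Generates Γ X
  generates-from-ε reach g with reach g
  ... | _ , _ , w with walk-word w
  ...   | xs , eq , xs⊆X = xs , trans (sym (identityˡ (prod Γ xs))) eq , λ y∈xs → inj₁ (xs⊆X y∈xs)

-- The group A × (C ≀ P) and its Cayley digraph

length-cartesianProductWith : ∀ {A B C : Set} (f : A → B → C) xs ys →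
  length (cartesianProductWith f xs ys) ≡ length xs * length ys
length-cartesianProductWith f []       ys = refl
length-cartesianProductWith f (x ∷ xs) ys =
  trans (length-++ (map (f x) ys)) (cong₂ _+_ (length-map (f x) ys) (length-cartesianProductWith f xs ys))

funToFin-cong : ∀ {k m} {f g : Fin k → Fin m} → (∀ i → f i ≡ g i) → funToFin f ≡ funToFin g
funToFin-cong {zero}  eq = refl
funToFin-cong {suc k} eq = cong₂ combine (eq zero) (funToFin-cong (eq ∘ suc))

Vec↔Fin^ : ∀ {m k} → Vec (Fin m) k ↔ Fin (m ^ k)
Vec↔Fin^ {m} {k} = mk↔ₛ′ (funToFin ∘ lookup) (tabulate ∘ finToFun)
  (λ i → trans (funToFin-cong {k} {m} (lookup∘tabulate (finToFun i))) (funToFin-finToFin {k} {m} i))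
  (λ v → trans (tabulate-cong (finToFun-funToFin (lookup v))) (tabulate∘lookup v))

module Wreath {a k m : ℕ} (A : FinGroup a) (P : FinGroup k) (C : FinGroup m) where
  private
    module A = ≡-Group (fromFinGroup A)
    module P = ≡-Group (fromFinGroup P)
    module C = ≡-Group (fromFinGroup C)

  H : ≡-Group
  H = directProduct (fromFinGroup A) (fromFinGroup P)

  Lamps : ≡-Group
  Lamps = vecGroup (fromFinGroup C) k

  rotate : ∀ {L : Set} → Fin k → Vec L k → Vec L k
  rotate r w = tabulate (λ i → lookup w (r P.⁻¹ P.∙ i))

  lookup-rotate : ∀ {L : Set} r (w : Vec L k) i → lookup (rotate r w) i ≡ lookup w (r P.⁻¹ P.∙ i)
  lookup-rotate r w = lookup∘tabulate (λ i → lookup w (r P.⁻¹ P.∙ i))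

  rotation : Action H Lamps
  rotation = record
    { act    = λ h → rotate (proj₂ h)
    ; act-∙ˡ = λ (_ , r) v w → lookup-extensionality λ i → begin
        lookup (rotate r (zipWith C._∙_ v w)) i                        ≡⟨ lookup-rotate r (zipWith C._∙_ v w) i ⟩
        lookup (zipWith C._∙_ v w) (r P.⁻¹ P.∙ i)                       ≡⟨ lookup-zipWith C._∙_ (r P.⁻¹ P.∙ i) v w ⟩
        lookup v (r P.⁻¹ P.∙ i) C.∙ lookup w (r P.⁻¹ P.∙ i)             ≡⟨ sym (cong₂ C._∙_ (lookup-rotate r v i) (lookup-rotate r w i)) ⟩
        lookup (rotate r v) i C.∙ lookup (rotate r w) i                 ≡⟨ sym (lookup-zipWith C._∙_ i (rotate r v) (rotate r w)) ⟩
        lookup (zipWith C._∙_ (rotate r v) (rotate r w)) i              ∎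
    ; act-ε  = λ w → lookup-extensionality λ i →
        trans (lookup-rotate P.ε w i) (cong (lookup w) (trans (cong (P._∙ i) P.ε⁻¹≈ε) (P.identityˡ i)))
    ; act-∙  = λ (_ , r) (_ , s) w → lookup-extensionality λ i → begin
        lookup (rotate (r P.∙ s) w) i                   ≡⟨ lookup-rotate (r P.∙ s) w i ⟩
        lookup w ((r P.∙ s) P.⁻¹ P.∙ i)                  ≡⟨ cong (λ x → lookup w (x P.∙ i)) (P.⁻¹-anti-homo-∙ r s) ⟩
        lookup w (s P.⁻¹ P.∙ r P.⁻¹ P.∙ i)               ≡⟨ cong (lookup w) (P.assoc (s P.⁻¹) (r P.⁻¹) i) ⟩
        lookup w (s P.⁻¹ P.∙ (r P.⁻¹ P.∙ i))             ≡⟨ sym (lookup-rotate s w _) ⟩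
        lookup (rotate s w) (r P.⁻¹ P.∙ i)               ≡⟨ sym (lookup-rotate r (rotate s w) i) ⟩
        lookup (rotate r (rotate s w)) i                 ∎
    }
    where open ≡-Reasoning

  W : ≡-Group
  W = semidirect H Lamps rotation

  open ≡-Group W using () renaming (_∙_ to _·_)

  opaque
    W↔Fin : ≡-Group.Carrier W ↔ Fin (a * k * m ^ k)
    W↔Fin = ↔-sym (↔-trans *↔× (*↔× ×-↔ ↔-sym Vec↔Fin^))

  Γ : FinGroup (a * k * m ^ k)
  Γ = transport W W↔Fin

  open FinGroup Γ using (_∙_; ε)
  open Inverse W↔Fin using (to; from; strictlyInverseˡ; strictlyInverseʳ)

  to-∙ : ∀ x y → to x ∙ to y ≡ to (x · y)
  to-∙ = transport-to-∙ W W↔Fin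

  δ : Fin m → Vec (Fin m) k
  δ c = Vec.replicate k C.ε [ P.ε ]≔ c

  -- rotate p (δ c) has c at position p and ε elsewhere.
  ·-δ : ∀ e p w t s x →
    ((e , p) , w) · ((t , s) , δ (lookup w p C.⁻¹ C.∙ x)) ≡ ((e A.∙ t , p P.∙ s) , w [ p ]≔ x)
  ·-δ e p w t s x = cong ((e A.∙ t , p P.∙ s) ,_) (lookup-extensionality λ i →
    trans (lookup-zipWith C._∙_ i w (rotate p (δ c))) (trans (cong (lookup w i C.∙_) (lookup-rotate p (δ c) i)) (lamp i)))
    where
    c : Fin m
    c = lookup w p C.⁻¹ C.∙ x
    lamp : ∀ i → lookup w i C.∙ lookup (δ c) (p P.⁻¹ P.∙ i) ≡ lookup (w [ p ]≔ x) i
    lamp i with i ≟ p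
    ... | yes refl = begin
      lookup w i C.∙ lookup (δ c) (i P.⁻¹ P.∙ i)     ≡⟨ cong (λ j → lookup w i C.∙ lookup (δ c) j) (P.inverseˡ i) ⟩
      lookup w i C.∙ lookup (δ c) P.ε                ≡⟨ cong (lookup w i C.∙_) (lookup∘update P.ε (Vec.replicate k C.ε) c) ⟩
      lookup w i C.∙ (lookup w i C.⁻¹ C.∙ x)          ≡⟨ sym (C.assoc _ _ x) ⟩
      lookup w i C.∙ lookup w i C.⁻¹ C.∙ x            ≡⟨ cong (C._∙ x) (C.inverseʳ (lookup w i)) ⟩
      C.ε C.∙ x                                      ≡⟨ C.identityˡ x ⟩
      x                                              ≡⟨ sym (lookup∘update i w x) ⟩
      lookup (w [ i ]≔ x) i                          ∎
      where open ≡-Reasoning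
    ... | no i≢p = trans (cong (lookup w i C.∙_)
                           (trans (lookup∘update′ p⁻¹i≢ε (Vec.replicate k C.ε) c)
                                  (lookup-replicate (p P.⁻¹ P.∙ i) C.ε)))
                     (trans (C.identityʳ (lookup w i)) (sym (lookup∘update′ i≢p w x)))
      where
      p⁻¹i≢ε : p P.⁻¹ P.∙ i ≢ P.ε
      p⁻¹i≢ε eq = i≢p (sym (P.⁻¹-injective (P.inverseˡ-unique (p P.⁻¹) i eq)))

  module Generators (t : Fin a) (S : List (Fin k)) where

    generator : Fin k → Fin m → Fin (a * k * m ^ k)
    generator s c = to ((t , s) , δ c)

    X : List (Fin (a * k * m ^ k))
    X = cartesianProductWith generator S (allFin m)

    generator-parity : ∀ {x} → x ∈ X → proj₁ (proj₁ (from x)) ≡ t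
    generator-parity x∈X with ∈-cartesianProductWith⁻ generator S (allFin m) x∈X
    ... | s , c , _ , _ , refl = cong (proj₁ ∘ proj₁) (strictlyInverseʳ ((t , s) , δ c))

    generator-injective : ∀ {s s′ c c′} → generator s c ≡ generator s′ c′ → s ≡ s′ × c ≡ c′
    generator-injective {s} {s′} {c} {c′} eq =
      cong (proj₂ ∘ proj₁) from-eq ,
      trans (sym (lookup-δ c)) (trans (cong (λ x → lookup (proj₂ x) P.ε) from-eq) (lookup-δ c′))
      where
      from-eq : ((t , s) , δ c) ≡ ((t , s′) , δ c′)
      from-eq = trans (sym (strictlyInverseʳ _)) (trans (cong from eq) (strictlyInverseʳ _))
      lookup-δ : ∀ c → lookup (δ c) P.ε ≡ c
      lookup-δ = lookup∘update P.ε (Vec.replicate k C.ε)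

    set-lamp : ∀ e p w s x → s ∈ S → Arc Γ X (to ((e , p) , w)) (to ((e A.∙ t , p P.∙ s) , w [ p ]≔ x))
    set-lamp e p w s x s∈S = generator s c , ∈-cartesianProductWith⁺ generator s∈S (∈-allFin c) ,
      trans (to-∙ ((e , p) , w) ((t , s) , δ c)) (cong to (·-δ e p w t s x))
      where
      c : Fin m
      c = lookup w p C.⁻¹ C.∙ x

    -- Each step sets the lamp at the current position to its target value; later
    -- steps only change the lamps they visit.
    greedy : ∀ (v : Vec (Fin m) k) ss → All (_∈ S) ss → ∀ e p w → ∃[ w′ ]
      ( Walk Γ X (to ((e , p) , w)) (to ((foldl A._∙_ e (map (const t) ss) , foldl P._∙_ p ss) , w′)) (length ss)
      × (∀ i → lookup w i ≡ lookup v i → lookup w′ i ≡ lookup v i)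
      × (∀ {i} → i ∈ partials P._∙_ p ss → lookup w′ i ≡ lookup v i))
    greedy v []       []           e p w = w , here , (λ _ eq → eq) , λ ()
    greedy v (s ∷ ss) (s∈S ∷ ss⊆S) e p w with greedy v ss ss⊆S (e A.∙ t) (p P.∙ s) (w [ p ]≔ lookup v p)
    ... | w′ , walk , keeps , visited =
      w′ , step (set-lamp e p w s (lookup v p) s∈S) walk , keeps′ , visited′
      where
      keeps′ : ∀ i → lookup w i ≡ lookup v i → lookup w′ i ≡ lookup v i
      keeps′ i wi≡vi with i ≟ p
      ... | yes refl = keeps i (lookup∘update i w (lookup v i))
      ... | no i≢p   = keeps i (trans (lookup∘update′ i≢p w (lookup v p)) wi≡vi)
      visited′ : ∀ {i} → i ∈ partials P._∙_ p (s ∷ ss) → lookup w′ i ≡ lookup v i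
      visited′ (here refl) = keeps p (lookup∘update p w (lookup v p))
      visited′ (there i∈)  = visited i∈

    X-length : length X ≡ length S * m
    X-length = trans (length-cartesianProductWith generator S (allFin m)) (cong (length S *_) (length-tabulate (λ i → i)))

    X-unique : Unique S → Unique X
    X-unique S-unique = cartesianProductWith⁺ generator generator-injective S-unique (allFin⁺ m)

    ε∉X : t ≢ A.ε → ε ∉ X
    ε∉X t≢ε ε∈X =
      t≢ε (trans (sym (generator-parity ε∈X)) (cong (proj₁ ∘ proj₁) (strictlyInverseʳ (≡-Group.ε W))))

    parity-step : ∀ u {x} → x ∈ X → proj₁ (proj₁ (from (u ∙ x))) ≡ proj₁ (proj₁ (from u)) A.∙ t
    parity-step u {x} x∈X = trans (cong (proj₁ ∘ proj₁) (strictlyInverseʳ (from u · from x)))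
                                  (cong (proj₁ (proj₁ (from u)) A.∙_) (generator-parity x∈X))

    walk-along : ∀ (v : Vec (Fin m) k) ss → All (_∈ S) ss → (∀ i → i ∈ partials P._∙_ P.ε ss) →
      Walk Γ X ε (to ((foldl A._∙_ A.ε (map (const t) ss) , foldl P._∙_ P.ε ss) , v)) (length ss)
    walk-along v ss ss⊆S visits-all with greedy v ss ss⊆S A.ε P.ε (Vec.replicate k C.ε)
    ... | w′ , walk , _ , visited =
      subst (λ w → Walk Γ X ε (to (end , w)) (length ss))
            (lookup-extensionality {v = w′} {v} (visited ∘ visits-all)) walk
      where
      end : Fin a × Fin k
      end = foldl A._∙_ A.ε (map (const t) ss) , foldl P._∙_ P.ε ss

module LamplighterCycle (K′ m′ : ℕ) where
  private
    module ℤ₂ = Cyclic 1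
    module ℤK = Cyclic K′
    module ℤM = Cyclic m′
  open Wreath ℤ₂.ℤ/ ℤK.ℤ/ ℤM.ℤ/
  open Generators ℤ₂.⟦ 1 ⟧ (map ℤK.⟦_⟧ (1 ∷ 2 ∷ []))
  open Inverse W↔Fin using (to; from; strictlyInverseˡ)
  open FinGroup Γ using (_∙_; ε)

  reach-from-ε : 2 ∣ suc K′ → ∀ e r v → ∃[ l ] (l ≤ suc (suc K′) × Walk Γ X ε (to ((e , r) , v)) l)
  reach-from-ε K-even e r v with tour-endpoint K′ (toℕ e) (toℕ r) (s≤s⁻¹ (toℕ<n e)) (toℕ<n r)
  ... | R , 0<R , R≤K , end≡r =
    length ss , length-bound ,
    subst (λ h → Walk Γ X ε (to (h , v)) (length ss)) (cong₂ _,_ parity-end position-end)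
          (walk-along v ss ss⊆S covered)
    where
    open Tour (tour K′ (toℕ e) R 0<R R≤K)
    ss : List (Fin (suc K′))
    ss = map ℤK.⟦_⟧ steps
    ss⊆S : All (_∈ map ℤK.⟦_⟧ (1 ∷ 2 ∷ [])) ss
    ss⊆S = All.map⁺ (All.map (∈-map⁺ ℤK.⟦_⟧) steps⊆)
    length-ss : length ss ≡ suc K′ + toℕ e
    length-ss = trans (length-map ℤK.⟦_⟧ steps) length≡
    length-bound : length ss ≤ suc (suc K′)
    length-bound = ≤-trans (≤-reflexive length-ss)
                           (≤-trans (+-monoʳ-≤ (suc K′) (s≤s⁻¹ (toℕ<n e))) (≤-reflexive (+-comm (suc K′) 1)))
    covered : ∀ i → i ∈ partials ℤK._⊕_ ℤK.⟦ 0 ⟧ ss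
    covered i with covers (toℕ i) (toℕ<n i)
    ... | y , y∈ , y≡i =
      subst (_ ∈_) (ℤK.partials-⟦⟧ 0 steps) (subst (_∈ _) (ℤK.⟦⟧-≡ y y≡i) (∈-map⁺ ℤK.⟦_⟧ y∈))
    parity-end : foldl ℤ₂._⊕_ ℤ₂.⟦ 0 ⟧ (map (const ℤ₂.⟦ 1 ⟧) ss) ≡ e
    parity-end = trans (ℤ₂.foldl-⊕-⟦1⟧ 0 ss) (ℤ₂.⟦⟧-≡ (length ss) (trans (cong (_% 2) length-ss)
      (trans (%-remove-+ˡ (toℕ e) K-even) (m<n⇒m%n≡m (toℕ<n e)))))
    position-end : foldl ℤK._⊕_ ℤK.⟦ 0 ⟧ ss ≡ r
    position-end =
      trans (ℤK.foldl-⊕-⟦⟧ 0 steps) (ℤK.⟦⟧-≡ (sum steps) (trans (cong (_% suc K′) sum≡) end≡r))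

  reach : 2 ∣ suc K′ → ∀ g → ∃[ l ] (l ≤ suc (suc K′) × Walk Γ X ε g l)
  reach K-even g = subst (λ x → ∃[ l ] (l ≤ suc (suc K′) × Walk Γ X ε x l)) (strictlyInverseˡ g)
    (reach-from-ε K-even (proj₁ (proj₁ (from g))) (proj₂ (proj₁ (from g))) (proj₂ (from g)))

  isZero : Fin 2 → Bool
  isZero zero    = true
  isZero (suc _) = false

  bipartite : Bipartite Γ X
  bipartite = isZero ∘ parity , λ u v (x , x∈X , ux≡v) same →
    flips (parity u) (trans same (cong isZero (trans (cong parity (sym ux≡v)) (parity-step u x∈X))))
    where
    parity : Fin (2 * suc K′ * suc m′ ^ suc K′) → Fin 2
    parity u = proj₁ (proj₁ (from u))
    flips : ∀ p → isZero p ≢ isZero (p ℤ₂.⊕ ℤ₂.⟦ 1 ⟧)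
    flips zero ()
    flips (suc zero) ()

  S-unique : 2 ≤ K′ → Unique (map ℤK.⟦_⟧ (1 ∷ 2 ∷ []))
  S-unique 2≤K′ = (⟦1⟧≢⟦2⟧ ∷ []) ∷ [] ∷ []
    where
    ⟦1⟧≢⟦2⟧ : ℤK.⟦ 1 ⟧ ≢ ℤK.⟦ 2 ⟧
    ⟦1⟧≢⟦2⟧ eq with trans (sym (ℤK.toℕ-⟦⟧-< (s≤s (≤-trans (n≤1+n 1) 2≤K′))))
                          (trans (cong toℕ eq) (ℤK.toℕ-⟦⟧-< (s≤s 2≤K′)))
    ... | ()

  bipartite-cayley-digraph : 2 ≤ K′ → 2 ∣ suc K′ →
    ∃[ Γ′ ] ∃[ X′ ] (GeneratingSetOfSize {2 * suc K′ * suc m′ ^ suc K′} Γ′ X′ (suc m′ * 2)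
                     × Bipartite Γ′ X′ × DiameterAtMost Γ′ X′ (suc (suc K′)))
  bipartite-cayley-digraph 2≤K′ K-even =
    Γ , X ,
    (X-unique (S-unique 2≤K′) , ε∉X (λ ()) , trans X-length (*-comm 2 (suc m′)) ,
     Cayley.generates-from-ε Γ X (reach K-even)) ,
    bipartite ,
    Cayley.diameter-from-ε Γ X (reach K-even)

pred-even : ∀ n → ¬ 2 ∣ suc n → 2 ∣ n
pred-even n odd with even-or-odd n
... | q , inj₁ n≡2q   = divides q n≡2q
... | q , inj₂ n≡1+2q = contradiction (divides (suc q) (cong suc n≡1+2q)) odd

theorem3 : (k d : ℕ) → ¬ (2 ∣ k) → 5 ≤ k → 2 ∣ d → 2 ≤ d →
    ∃[ Γ ] ∃[ X ]
      (GeneratingSetOfSize {2 * (k ∸ 1) * ((d / 2) ^ (k ∸ 1))} Γ X d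
        × Bipartite Γ X
        × DiameterAtMost Γ X k)
theorem3 (suc (suc K′)) .(suc m′ * 2) k-odd (s≤s (s≤s 3≤K′)) (divides (suc m′) refl) _
  rewrite m*n/n≡m (suc m′) 2 ⦃ _ ⦄ =
    LamplighterCycle.bipartite-cayley-digraph K′ m′ (≤-trans (n≤1+n 2) 3≤K′) (pred-even (suc K′) k-odd)
theorem3 _ .(0 * 2) _ _ (divides zero refl) ()
theorem3 (suc zero) _ _ (s≤s ()) _ _
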